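{- Under the standing assumptions below, let $c\in\mathcal{C}_{n-1}(n,q)$ with $\mathrm{wt}(c)\leq W(n,q)$ and suppose that $|\mathbb{H}_c^\infty|=2$. Then $c$ is not minimal.
   Context: Standing assumptions: $p$ is a prime, $q=p^h$ with $h\geq 2$, $q>27$, $n\geq 2$, and $q\geq\max\{32,2^{2n-4}\}$ if $h>2$, while $q\geq 2^{2n}$ if $h=2$. $\mathrm{PG}(n,q)$ is the Desarguesian projective space over $\mathbb{F}_q$; $\theta_m:=\frac{q^{m+1}-1}{q-1}$. $\mathcal{C}_{n-1}(n,q)$ is the $\mathbb{F}_p$-span of the characteristic functions (values in $\mathbb{F}_p$) of the hyperplanes of $\mathrm{PG}(n,q)$, as functions on points; hyperplanes are identified with their characteristic functions. $\mathrm{supp}(c)=\{P:c(P)\neq0\}$, $\mathrm{wt}(c)=|\mathrm{supp}(c)|$, $m_c:=\lceil\mathrm{wt}(c)/\theta_{n-1}\rceil$. $\Delta_{n,q}:=\lfloor 2^{ -(n-2)}\sqrt{q}\rfloor$ if $h>2$, $\Delta_{n,q}:=\lfloor p/2^n\rfloor$ if $h=2$; $W(n,q):=(\Delta_{n,q}-1)\theta_{n-1}$. For $c$ with $\mathrm{wt}(c)\leq W(n,q)$, $c$ is a linear combination with nonzero coefficients of a uniquely determined set $\mathcal{H}_c$ of exactly $m_c$ distinct hyperplanes, with uniquely determined coefficients; write $c(H)$ for the coefficient of $H\in\mathcal{H}_c$. For $\mathcal{H}\subseteq\mathcal{H}_c$ put $c|_{\mathcal{H}}:=\sum_{H\in\mathcal{H}}c(H)H$.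 Points not in $\mathrm{supp}(c)$ are holes of $c$. For a partition $\mathbb{H}$ of $\mathcal{H}_c$, let $\Gamma_{\mathbb{H}}$ be the graph with vertex set $\mathbb{H}$ in which distinct $\mathcal{H}_1,\mathcal{H}_2$ are adjacent iff there is a point $P$ such that: $P$ is a hole of $c$; $c|_{\mathcal{H}_1}(P)\neq0$ and $c|_{\mathcal{H}_2}(P)\neq0$; and $c|_{\mathcal{H}}(P)=0$ for all $\mathcal{H}\in\mathbb{H}\setminus\{\mathcal{H}_1,\mathcal{H}_2\}$. Let $\mathbb{H}_c^0$ be the partition of $\mathcal{H}_c$ into singletons, and $\mathbb{H}_c^{i+1}$ the partition whose parts are the unions of the parts in each connected component of $\Gamma_{\mathbb{H}_c^i}$. This sequence stabilizes; $\mathbb{H}_c^\infty$ is the eventual constant partition. A codeword $c$ is minimal if for every $c'\in\mathcal{C}_{n-1}(n,q)$ with $\mathrm{supp}(c')\subseteq\mathrm{supp}(c)$ there is $\alpha\in\mathbb{F}_p$ with $c'=\alpha c$. -}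

module Defs where

open import Level using (0ℓ)
open import Data.Bool using (Bool; true; false; if_then_else_; T)
open import Data.Nat using (ℕ; zero; suc; _+_; _*_; _∸_; _^_; _≤_; _<_; NonZero; _≡ᵇ_; _≤ᵇ_)
open import Data.Nat.Properties using (m^n≢0)
open import Data.Nat.DivMod using (_mod_)
open import Data.Nat.Primality using (Prime; prime⇒nonZero)
open import Data.Fin using (Fin; toℕ) renaming (zero to fzero; suc to fsuc)
import Data.Fin as Fin
open import Data.Vec using (Vec; []; _∷_)
open import Data.List using (List; []; _∷_; [_]; length; map; concatMap; filter; mapMaybe)
open import Data.List.Membership.Propositional using (_∈_)
open import Data.List.Relation.Unary.Unique.Propositional using (Unique)
open import Data.Maybe using (Maybe; just; nothing)
open import Data.Product using (Σ; ∃; _×_; _,_; proj₁)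
open import Data.Sum using (_⊎_)
open import Relation.Nullary using (¬_; yes; no; ¬?; does)
open import Relation.Nullary.Decidable using (⌊_⌋)
open import Relation.Binary.PropositionalEquality using (_≡_; _≢_)
open import Relation.Binary.Construct.Closure.ReflexiveTransitive using (Star)
open import Algebra.Core using (Op₁; Op₂)
open import Algebra.Structures using (IsCommutativeRing)
open import Data.Bool.Properties using (T?)

record FiniteField : Set₁ where
  field
    Carrier : Set
    _⊕_ _⊗_ : Op₂ Carrier
    ⊖_      : Op₁ Carrier
    0# 1#   : Carrier
    isCommutativeRing : IsCommutativeRing _≡_ _⊕_ _⊗_ ⊖_ 0# 1#
    0≢1     : 0# ≢ 1#
    inverse : ∀ x → x ≢ 0# → ∃ λ y → x ⊗ y ≡ 1#
    _≟_     : (x y : Carrier) → Relation.Nullary.Dec (x ≡ y)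
    elements : List Carrier
    elements-unique   : Unique elements
    elements-complete : ∀ x → x ∈ elements

order : FiniteField → ℕ
order F = length (FiniteField.elements F)

-- θ q m = 1 + q + ... + q^m = (q^(m+1) - 1)/(q - 1)
θ : ℕ → ℕ → ℕ
θ q zero    = 1
θ q (suc m) = 1 + q * θ q m

θ-nonZero : ∀ q m → NonZero (θ q m)
θ-nonZero q zero    = _
θ-nonZero q (suc m) = _

ceilDivθ : ℕ → ℕ → ℕ → ℕ
ceilDivθ a q m = Data.Nat._/_ (a + (θ q m ∸ 1)) (θ q m) {{θ-nonZero q m}}

isqrt : ℕ → ℕ
isqrt zero    = 0
isqrt (suc n) = if (suc (isqrt n) * suc (isqrt n)) ≤ᵇ suc n then suc (isqrt n) else isqrt n

div2^ : ℕ → ℕ → ℕ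
div2^ a k = Data.Nat._/_ a (2 ^ k) {{m^n≢0 2 k}}

-- Δ_{n,q} : ⌊2^{-(n-2)} √q⌋ if h > 2, ⌊p / 2^n⌋ if h = 2
-- (⌊⌊√q⌋ / 2^{n-2}⌋ = ⌊√q / 2^{n-2}⌋ since 2^{n-2} is a positive integer)
Δ : (p h n q : ℕ) → ℕ
Δ p h n q = if h ≡ᵇ 2 then div2^ p n else div2^ (isqrt q) (n ∸ 2)

W : (p h n q : ℕ) → ℕ
W p h n q = (Δ p h n q ∸ 1) * θ q (n ∸ 1)

record Standing (p h n q : ℕ) : Set where
  field
    p-prime : Prime p
    h≥2     : 2 ≤ h
    q≡p^h   : q ≡ p ^ h
    q>27    : 27 < q
    n≥2     : 2 ≤ n
    h>2-bound : 2 < h → 32 ≤ q × 2 ^ (2 * n ∸ 4) ≤ q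
    h≡2-bound : h ≡ 2 → 2 ^ (2 * n) ≤ q

module PG (F : FiniteField) (n : ℕ) (p : ℕ) (pp : Prime p) where
  open FiniteField F renaming (Carrier to K)

  private
    instance
      p≢0 : NonZero p
      p≢0 = prime⇒nonZero pp

  q : ℕ
  q = order F

  -- normalised homogeneous coordinates: first nonzero coordinate is 1
  isNorm : ∀ {k} → Vec K k → Bool
  isNorm []      = false
  isNorm (x ∷ v) with x ≟ 0#
  ... | yes _ = isNorm v
  ... | no  _ = ⌊ x ≟ 1# ⌋

  Point : Set
  Point = Σ (Vec K (suc n)) (λ v → T (isNorm v))

  -- hyperplanes, given by normalised dual coordinates
  Hyperplane : Set
  Hyperplane = Point

  dot : ∀ {k} → Vec K k → Vec K k → K
  dot []       []       = 0#
  dot (x ∷ u) (y ∷ v) = (x ⊗ y) ⊕ dot u v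

  allVecs : (k : ℕ) → List (Vec K k)
  allVecs zero    = [ [] ]
  allVecs (suc k) = concatMap (λ x → map (x ∷_) (allVecs k)) elements

  toPoint : Vec K (suc n) → Maybe Point
  toPoint v with T? (isNorm v)
  ... | yes t = just (v , t)
  ... | no  _ = nothing

  allPoints : List Point
  allPoints = mapMaybe toPoint (allVecs (suc n))

  Fp : Set
  Fp = Fin p

  0ₚ 1ₚ : Fp
  0ₚ = 0 mod p
  1ₚ = 1 mod p

  _+ₚ_ _*ₚ_ : Fp → Fp → Fp
  a +ₚ b = (toℕ a + toℕ b) mod p
  a *ₚ b = (toℕ a * toℕ b) mod p

  sumₚ : ∀ {m} → (Fin m → Fp) → Fp
  sumₚ {zero}  f = 0ₚ
  sumₚ {suc m} f = f fzero +ₚ sumₚ (λ i → f (fsuc i))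

  Fun : Set
  Fun = Point → Fp

  χ : Hyperplane → Fun
  χ H P with dot (proj₁ H) (proj₁ P) ≟ 0#
  ... | yes _ = 1ₚ
  ... | no  _ = 0ₚ

  comb : ∀ {m} → (Fin m → Hyperplane) → (Fin m → Fp) → Fun
  comb Hs a P = sumₚ (λ i → a i *ₚ χ (Hs i) P)

  -- membership in C_{n-1}(n,q) (the F_p-span of the hyperplanes)
  InCode : Fun → Set
  InCode c = Σ ℕ λ m → Σ (Fin m → Hyperplane) λ Hs → Σ (Fin m → Fp) λ a →
             ∀ P → c P ≡ comb Hs a P

  wt : Fun → ℕ
  wt c = length (filter (λ P → ¬? (c P Fin.≟ 0ₚ)) allPoints)

  mc : Fun → ℕ
  mc c = ceilDivθ (wt c) q (n ∸ 1)

  Hole : Fun → Point → Set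
  Hole c P = c P ≡ 0ₚ

  record IsHc (c : Fun) {m : ℕ} (Hs : Fin m → Hyperplane) (a : Fin m → Fp) : Set where
    field
      size     : m ≡ mc c
      distinct : ∀ i j → Hs i ≡ Hs j → i ≡ j
      nonzero  : ∀ i → a i ≢ 0ₚ
      sum      : ∀ P → c P ≡ comb Hs a P

  Minimal : Fun → Set
  Minimal c = ∀ c' → InCode c' → (∀ P → c' P ≢ 0ₚ → c P ≢ 0ₚ) →
              Σ Fp λ α → ∀ P → c' P ≡ α *ₚ c P

  -- Partitions of H_c (indexed by Fin m) are given by labellings
  -- π : Fin m → Fin m; i and j lie in the same part iff π i ≡ π j.
  module Partitions (c : Fun) {m : ℕ} (Hs : Fin m → Hyperplane) (a : Fin m → Fp) where

    Labelling : Set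
    Labelling = Fin m → Fin m

    restr : Labelling → Fin m → Fun
    restr π i P = sumₚ (λ j → if ⌊ π j Fin.≟ π i ⌋ then a j *ₚ χ (Hs j) P else 0ₚ)

    Adj : Labelling → Fin m → Fin m → Set
    Adj π i j = π i ≢ π j × Σ Point λ P →
                Hole c P × restr π i P ≢ 0ₚ × restr π j P ≢ 0ₚ ×
                (∀ k → π k ≢ π i → π k ≢ π j → restr π k P ≡ 0ₚ)

    Step : Labelling → Fin m → Fin m → Set
    Step π i j = π i ≡ π j ⊎ Adj π i j

    -- π' is the partition into unions of parts of connected components of Γ_π
    IsNext : Labelling → Labelling → Set
    IsNext π π' = ∀ i j → (π' i ≡ π' j → Star (Step π) i j) × (Star (Step π) i j → π' i ≡ π' j)

    -- πs k represents H_c^k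
    IsSequence : (ℕ → Labelling) → Set
    IsSequence πs = (∀ i j → πs 0 i ≡ πs 0 j → i ≡ j) × (∀ k → IsNext (πs k) (πs (suc k)))

    TwoParts : Labelling → Set
    TwoParts π = Σ (Fin m) λ i → Σ (Fin m) λ j → π i ≢ π j × (∀ k → π k ≡ π i ⊎ π k ≡ π j)

    -- |H_c^∞| = 2 : eventually (hence at the stable stage) exactly two parts
    LimitTwoParts : (ℕ → Labelling) → Set
    LimitTwoParts πs = Σ ℕ λ K → ∀ k → K ≤ k → TwoParts (πs k)

module Submission where

-- Let H_c^∞ = {𝓗₁, 𝓗₂}, reached at stage K, and c′ = c|𝓗₁, a codeword. If c′ were
-- nonzero at a hole P of c, then c|𝓗₂(P) = −c′(P) ≠ 0 as well, so 𝓗₁ and 𝓗₂ would be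
-- adjacent in Γ and merge at stage K + 1; hence supp c′ ⊆ supp c. As |𝓗_c| = m_c ≤ Δ − 1 < q,
-- each hyperplane of 𝓗_c has a point lying on no other one. At such a point of a hyperplane
-- of 𝓗₂, c′ vanishes but c does not, so c′ is not a multiple of c; yet c′ ≠ 0, as it does not
-- vanish at such a point of a hyperplane of 𝓗₁.

open import Defs
open import Data.Nat using (ℕ; zero; suc; _≤_; _<_; z≤n; s≤s)
open import Data.Nat.Primality using (Prime)
open import Data.Fin using (Fin)
open import Relation.Nullary using (¬_)

open import Level using (0ℓ)
open import Algebra.Bundles using (CommutativeMonoid; CommutativeRing)
import Algebra.Properties.CommutativeSemigroup as CommutativeSemigroupProperties
import Algebra.Properties.Ring as RingProperties
open import Data.Bool using (T; true; false; if_then_else_)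
open import Data.Bool.Properties using (T-irrelevant)
open import Data.Empty using (⊥-elim)
import Data.Fin as Fin
open import Data.Fin using (toℕ) renaming (zero to fzero; suc to fsuc)
open import Data.List using (List; []; _∷_; length; filter; allFin)
import Data.List as List
open import Data.List.Properties using (filter-notAll; length-map; length-filter; length-tabulate)
open import Data.List.Membership.Propositional using (_∈_; _∉_)
open import Data.List.Membership.Propositional.Properties using (∈-filter⁺; ∈-filter⁻; ∈-map⁺; ∈-allFin)
open import Data.List.Relation.Unary.Any as Any using (here; there)
import Data.List.Relation.Unary.All as All
open import Data.List.Relation.Unary.AllPairs using (_∷_)
open import Data.List.Relation.Unary.Unique.Propositional using (Unique)
import Data.Nat.Properties as ℕ
open import Data.Product using (∃; _×_; _,_; proj₁; proj₂)
open import Data.Sum using (_⊎_; inj₁; inj₂; [_,_]′)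
open import Data.Vec using (Vec; []; _∷_; replicate; zipWith; map)
open import Function using (_∘_; id)
open import Relation.Binary.Construct.Closure.ReflexiveTransitive using (ε; _◅_)
open import Relation.Binary.Definitions using (DecidableEquality)
open import Relation.Binary.PropositionalEquality
open import Relation.Nullary using (yes; no; ¬?)
open import Relation.Nullary.Decidable using (⌊_⌋)

module _ {A : Set} (_≟ₐ_ : DecidableEquality A) where
  open import Data.List.Membership.DecPropositional _≟ₐ_ using (_∈?_)

  pigeonhole-∉ : (xs : List A) → Unique xs → (L : List A) → length L < length xs →
                 ∃ λ t → t ∈ xs × t ∉ L
  pigeonhole-∉ (x ∷ xs) (x∉xs ∷ xs-unique) L |L|<|x∷xs| with x ∈? L
  ... | no x∉L = x , here refl , x∉L
  ... | yes x∈L =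
    let L⁻ = filter (λ b → ¬? (x ≟ₐ b)) L
        |L⁻|<|xs| = ℕ.<-≤-trans (filter-notAll _ L (Any.map (λ x≡b x≢b → x≢b x≡b) x∈L))
                                (ℕ.≤-pred |L|<|x∷xs|)
        t , t∈xs , t∉L⁻ = pigeonhole-∉ xs xs-unique L⁻ |L⁻|<|xs|
    in t , there t∈xs , λ t∈L → t∉L⁻ (∈-filter⁺ _ t∈L (All.lookup x∉xs t∈xs))

-- Defs defines the arithmetic of F_p inside PG, hence the otherwise irrelevant parameters F and n.
module PrimeFieldArithmetic (F : FiniteField) (n p : ℕ) (pp : Prime p) where
  open import Data.Nat using (_+_; _*_; _%_; NonZero)
  open import Data.Nat.Base using (>-nonZero⁻¹; nonTrivial⇒n>1)
  open import Data.Nat.DivMod using (_mod_; %-distribˡ-+; m%n%n≡m%n; m<n⇒m%n≡m)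
  open import Data.Nat.Divisibility using (_∣_; n∣m⇒m%n≡0; m%n≡0⇒n∣m)
  open import Data.Nat.Primality using (prime⇒nonZero; prime⇒nonTrivial; euclidsLemma)
  open import Data.Fin.Properties using (toℕ-injective; toℕ<n; toℕ-fromℕ<; punchInᵢ≢i)
  open import Data.Vec.Functional using (removeAt)
  open PG F n p pp

  private instance
    p≢0 : NonZero p
    p≢0 = prime⇒nonZero pp

  toℕ-mod : ∀ m → toℕ (m mod p) ≡ m % p
  toℕ-mod m = toℕ-fromℕ< _

  toℕ-0ₚ : toℕ 0ₚ ≡ 0
  toℕ-0ₚ = trans (toℕ-mod 0) (m<n⇒m%n≡m (>-nonZero⁻¹ p))

  toℕ-1ₚ : toℕ 1ₚ ≡ 1
  toℕ-1ₚ = trans (toℕ-mod 1) (m<n⇒m%n≡m (nonTrivial⇒n>1 p {{prime⇒nonTrivial pp}}))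

  mod-toℕ : ∀ x → toℕ x mod p ≡ x
  mod-toℕ x = toℕ-injective (trans (toℕ-mod (toℕ x)) (m<n⇒m%n≡m (toℕ<n x)))

  toℕ≡0⇒≡0ₚ : ∀ {x} → toℕ x ≡ 0 → x ≡ 0ₚ
  toℕ≡0⇒≡0ₚ e = toℕ-injective (trans e (sym toℕ-0ₚ))

  [m%p+n]%p≡[m+n]%p : ∀ m n → (m % p + n) % p ≡ (m + n) % p
  [m%p+n]%p≡[m+n]%p m n = begin
    (m % p + n) % p            ≡⟨ %-distribˡ-+ (m % p) n p ⟩
    (m % p % p + n % p) % p    ≡⟨ cong (λ k → (k + n % p) % p) (m%n%n≡m%n m p) ⟩
    (m % p + n % p) % p        ≡⟨ %-distribˡ-+ m n p ⟨
    (m + n) % p                ∎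
    where open ≡-Reasoning

  +ₚ-comm : ∀ x y → x +ₚ y ≡ y +ₚ x
  +ₚ-comm x y = cong (_mod p) (ℕ.+-comm (toℕ x) (toℕ y))

  +ₚ-assoc : ∀ x y z → (x +ₚ y) +ₚ z ≡ x +ₚ (y +ₚ z)
  +ₚ-assoc x y z = toℕ-injective (begin
    toℕ ((x +ₚ y) +ₚ z)          ≡⟨ toℕ-mod _ ⟩
    (toℕ (x +ₚ y) + toℕ z) % p   ≡⟨ cong (λ k → (k + toℕ z) % p) (toℕ-mod _) ⟩
    ((a + b) % p + c) % p        ≡⟨ [m%p+n]%p≡[m+n]%p (a + b) c ⟩
    (a + b + c) % p              ≡⟨ cong (_% p) (ℕ.+-assoc a b c) ⟩
    (a + (b + c)) % p            ≡⟨ cong (_% p) (ℕ.+-comm a (b + c)) ⟩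
    (b + c + a) % p              ≡⟨ [m%p+n]%p≡[m+n]%p (b + c) a ⟨
    ((b + c) % p + a) % p        ≡⟨ cong (_% p) (ℕ.+-comm ((b + c) % p) a) ⟩
    (a + (b + c) % p) % p        ≡⟨ cong (λ k → (a + k) % p) (toℕ-mod _) ⟨
    (a + toℕ (y +ₚ z)) % p       ≡⟨ toℕ-mod _ ⟨
    toℕ (x +ₚ (y +ₚ z))          ∎)
    where
    open ≡-Reasoning
    a = toℕ x; b = toℕ y; c = toℕ z

  +ₚ-identityˡ : ∀ x → 0ₚ +ₚ x ≡ x
  +ₚ-identityˡ x = trans (cong (λ k → (k + toℕ x) mod p) toℕ-0ₚ) (mod-toℕ x)

  +ₚ-identityʳ : ∀ x → x +ₚ 0ₚ ≡ x
  +ₚ-identityʳ x = trans (+ₚ-comm x 0ₚ) (+ₚ-identityˡ x)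

  +ₚ-commutativeMonoid : CommutativeMonoid 0ℓ 0ℓ
  +ₚ-commutativeMonoid = record
    { _∙_ = _+ₚ_
    ; ε = 0ₚ
    ; isCommutativeMonoid = record
      { isMonoid = record
        { isSemigroup = record
          { isMagma = record { isEquivalence = isEquivalence ; ∙-cong = cong₂ _+ₚ_ }
          ; assoc = +ₚ-assoc
          }
        ; identity = +ₚ-identityˡ , +ₚ-identityʳ
        }
      ; comm = +ₚ-comm
      }
    }

  *ₚ-zeroˡ : ∀ x → 0ₚ *ₚ x ≡ 0ₚ
  *ₚ-zeroˡ x = cong (λ k → (k * toℕ x) mod p) toℕ-0ₚ

  *ₚ-zeroʳ : ∀ x → x *ₚ 0ₚ ≡ 0ₚ
  *ₚ-zeroʳ x = cong (_mod p) (trans (cong (toℕ x *_) toℕ-0ₚ) (ℕ.*-zeroʳ (toℕ x)))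

  *ₚ-identityʳ : ∀ x → x *ₚ 1ₚ ≡ x
  *ₚ-identityʳ x = trans (cong (λ k → (toℕ x * k) mod p) toℕ-1ₚ)
                         (trans (cong (_mod p) (ℕ.*-identityʳ (toℕ x))) (mod-toℕ x))

  *ₚ≡0ₚ⇒≡0ₚ⊎≡0ₚ : ∀ x y → x *ₚ y ≡ 0ₚ → x ≡ 0ₚ ⊎ y ≡ 0ₚ
  *ₚ≡0ₚ⇒≡0ₚ⊎≡0ₚ x y xy≡0 =
    Data.Sum.map (p∣⇒≡0ₚ x) (p∣⇒≡0ₚ y) (euclidsLemma (toℕ x) (toℕ y) pp p∣xy)
    where
    p∣⇒≡0ₚ : ∀ z → p ∣ toℕ z → z ≡ 0ₚ
    p∣⇒≡0ₚ z p∣z = toℕ≡0⇒≡0ₚ (trans (sym (m<n⇒m%n≡m (toℕ<n z))) (n∣m⇒m%n≡0 _ _ p∣z))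
    p∣xy : p ∣ toℕ x * toℕ y
    p∣xy = m%n≡0⇒n∣m _ _ (trans (sym (toℕ-mod _)) (trans (cong toℕ xy≡0) toℕ-0ₚ))

  open import Algebra.Properties.CommutativeMonoid.Sum +ₚ-commutativeMonoid
    using (sum; ∑-distrib-+; sum-cong-≗; sum-remove; sum-replicate-zero)

  sumₚ≡sum : ∀ {m} (f : Fin m → Fp) → sumₚ f ≡ sum f
  sumₚ≡sum {zero}  f = refl
  sumₚ≡sum {suc m} f = cong (f fzero +ₚ_) (sumₚ≡sum (λ j → f (fsuc j)))

  sumₚ-cong : ∀ {m} {f g : Fin m → Fp} → (∀ j → f j ≡ g j) → sumₚ f ≡ sumₚ g
  sumₚ-cong {f = f} {g} f≗g = trans (sumₚ≡sum f) (trans (sum-cong-≗ f≗g) (sym (sumₚ≡sum g)))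

  sumₚ-distrib : ∀ {m} (f g : Fin m → Fp) → sumₚ (λ j → f j +ₚ g j) ≡ sumₚ f +ₚ sumₚ g
  sumₚ-distrib f g = trans (sumₚ≡sum (λ j → f j +ₚ g j))
                           (trans (∑-distrib-+ f g) (sym (cong₂ _+ₚ_ (sumₚ≡sum f) (sumₚ≡sum g))))

  sumₚ-select : ∀ {m} (f : Fin m → Fp) i → (∀ j → j ≢ i → f j ≡ 0ₚ) → sumₚ f ≡ f i
  sumₚ-select {suc m} f i f≡0 = begin
    sumₚ f                          ≡⟨ sumₚ≡sum f ⟩
    sum f                           ≡⟨ sum-remove {i = i} f ⟩
    f i +ₚ sum (removeAt f i)       ≡⟨ cong (f i +ₚ_) (sum-cong-≗ {m} (λ j → f≡0 _ (punchInᵢ≢i i j))) ⟩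
    f i +ₚ sum {m} (λ _ → 0ₚ)       ≡⟨ cong (f i +ₚ_) (sum-replicate-zero m) ⟩
    f i +ₚ 0ₚ                       ≡⟨ +ₚ-identityʳ (f i) ⟩
    f i                             ∎
    where open ≡-Reasoning

module PointsOffHyperplanes (F : FiniteField) (n p : ℕ) (pp : Prime p) where
  open FiniteField F using (0#; 1#; _≟_; inverse; 0≢1; elements; elements-unique; isCommutativeRing)
    renaming (Carrier to K)
  open PG F n p pp using (dot; isNorm; Point; Hyperplane; χ; 0ₚ; 1ₚ)

  ring : CommutativeRing 0ℓ 0ℓ
  ring = record { isCommutativeRing = isCommutativeRing }

  open CommutativeRing ring
    using (_+_; _*_; -_; +-identityˡ; +-identityʳ; zeroˡ; zeroʳ; *-identityˡ; *-identityʳ; -‿inverseˡ;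
           *-comm; *-assoc; distribˡ; +-commutativeSemigroup)
  open RingProperties (CommutativeRing.ring ring) using (+-inverseʳ-unique; -‿involutive; -‿distribʳ-*)
  open CommutativeSemigroupProperties +-commutativeSemigroup using (interchange)

  x*y≢0 : ∀ {x y} → x ≢ 0# → y ≢ 0# → x * y ≢ 0#
  x*y≢0 {x} {y} x≢0 y≢0 xy≡0 with inverse x x≢0
  ... | x⁻¹ , xx⁻¹≡1 = y≢0 (begin
    y               ≡⟨ *-identityˡ y ⟨
    1# * y          ≡⟨ cong (_* y) (trans (*-comm x⁻¹ x) xx⁻¹≡1) ⟨
    (x⁻¹ * x) * y   ≡⟨ *-assoc x⁻¹ x y ⟩
    x⁻¹ * (x * y)   ≡⟨ cong (x⁻¹ *_) xy≡0 ⟩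
    x⁻¹ * 0#        ≡⟨ zeroʳ x⁻¹ ⟩
    0#              ∎)
    where open ≡-Reasoning

  infixl 6 _+ᵥ_
  infixr 7 _·ᵥ_

  0ᵥ : ∀ {k} → Vec K k
  0ᵥ = replicate _ 0#

  _+ᵥ_ : ∀ {k} → Vec K k → Vec K k → Vec K k
  _+ᵥ_ = zipWith _+_

  _·ᵥ_ : ∀ {k} → K → Vec K k → Vec K k
  t ·ᵥ v = map (t *_) v

  dot-0ᵥʳ : ∀ {k} (g : Vec K k) → dot g 0ᵥ ≡ 0#
  dot-0ᵥʳ []      = refl
  dot-0ᵥʳ (x ∷ g) = trans (cong₂ _+_ (zeroʳ x) (dot-0ᵥʳ g)) (+-identityʳ 0#)

  dot-0ᵥˡ : ∀ {k} (v : Vec K k) → dot 0ᵥ v ≡ 0#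
  dot-0ᵥˡ []      = refl
  dot-0ᵥˡ (x ∷ v) = trans (cong₂ _+_ (zeroˡ x) (dot-0ᵥˡ v)) (+-identityʳ 0#)

  dot-·ᵥʳ : ∀ {k} (g v : Vec K k) t → dot g (t ·ᵥ v) ≡ t * dot g v
  dot-·ᵥʳ []      []      t = sym (zeroʳ t)
  dot-·ᵥʳ (x ∷ g) (y ∷ v) t = begin
    x * (t * y) + dot g (t ·ᵥ v)  ≡⟨ cong₂ _+_ x[ty]≡t[xy] (dot-·ᵥʳ g v t) ⟩
    t * (x * y) + t * dot g v     ≡⟨ distribˡ t _ _ ⟨
    t * (x * y + dot g v)         ∎
    where
    open ≡-Reasoning
    x[ty]≡t[xy] : x * (t * y) ≡ t * (x * y)
    x[ty]≡t[xy] = trans (sym (*-assoc x t y)) (trans (cong (_* y) (*-comm x t)) (*-assoc t x y))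

  dot-+ᵥʳ : ∀ {k} (g u v : Vec K k) → dot g (u +ᵥ v) ≡ dot g u + dot g v
  dot-+ᵥʳ []      []      []      = sym (+-identityʳ 0#)
  dot-+ᵥʳ (x ∷ g) (y ∷ u) (z ∷ v) = begin
    x * (y + z) + dot g (u +ᵥ v)              ≡⟨ cong₂ _+_ (distribˡ x y z) (dot-+ᵥʳ g u v) ⟩
    (x * y + x * z) + (dot g u + dot g v)     ≡⟨ interchange _ _ _ _ ⟩
    (x * y + dot g u) + (x * z + dot g v)     ∎
    where open ≡-Reasoning

  dot-linear : ∀ {k} (g v w : Vec K k) t → dot g (v +ᵥ t ·ᵥ w) ≡ dot g v + t * dot g w
  dot-linear g v w t = trans (dot-+ᵥʳ g v (t ·ᵥ w)) (cong (dot g v +_) (dot-·ᵥʳ g w t))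

  dot-0∷ : ∀ {k} x (g u : Vec K k) → dot (x ∷ g) (0# ∷ u) ≡ dot g u
  dot-0∷ x g u = trans (cong (_+ dot g u) (zeroʳ x)) (+-identityˡ _)

  dot-e₁ : ∀ {k} x (g : Vec K k) → dot (x ∷ g) (1# ∷ 0ᵥ) ≡ x
  dot-e₁ x g = trans (cong₂ _+_ (*-identityʳ x) (dot-0ᵥʳ g)) (+-identityʳ x)

  dot-distinguishes : ∀ {k} (a b : Vec K k) → a ≢ b → ∃ λ u → dot a u ≢ dot b u
  dot-distinguishes []      []      a≢b = ⊥-elim (a≢b refl)
  dot-distinguishes (x ∷ a) (y ∷ b) a≢b with x ≟ y
  ... | no x≢y = (1# ∷ 0ᵥ) , λ e → x≢y (trans (sym (dot-e₁ x a)) (trans e (dot-e₁ y b)))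
  ... | yes refl =
    let u , au≢bu = dot-distinguishes a b (a≢b ∘ cong (x ∷_))
    in (0# ∷ u) , λ e → au≢bu (trans (sym (dot-0∷ x a u)) (trans e (dot-0∷ x b u)))

  isNorm-0∷ : ∀ {k x} {v : Vec K k} → x ≡ 0# → T (isNorm v) → T (isNorm (x ∷ v))
  isNorm-0∷ {x = x} x≡0 t with x ≟ 0#
  ... | yes _   = t
  ... | no x≢0 = ⊥-elim (x≢0 x≡0)

  isNorm-∷ : ∀ {k x} {v : Vec K k} → T (isNorm (x ∷ v)) → (x ≡ 0# × T (isNorm v)) ⊎ x ≡ 1#
  isNorm-∷ {x = x} t with x ≟ 0#
  ... | yes x≡0 = inj₁ (x≡0 , t)
  ... | no _ with x ≟ 1#
  ...   | yes x≡1 = inj₂ x≡1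
  ...   | no _    = ⊥-elim t

  isNorm-1∷ : ∀ {k} {v : Vec K k} → T (isNorm (1# ∷ v))
  isNorm-1∷ with 1# ≟ 0#
  ... | yes 1≡0 = ⊥-elim (0≢1 (sym 1≡0))
  ... | no _ with 1# ≟ 1#
  ...   | yes _  = _
  ...   | no 1≢1 = ⊥-elim (1≢1 refl)

  isNorm⇒≢0ᵥ : ∀ {k} {v : Vec K k} → T (isNorm v) → v ≢ 0ᵥ
  isNorm⇒≢0ᵥ {v = []} ()
  isNorm⇒≢0ᵥ {suc k} {v = x ∷ v} t refl with isNorm-∷ t
  ... | inj₁ (_ , t′) = isNorm⇒≢0ᵥ {k} t′ refl
  ... | inj₂ 0≡1     = 0≢1 0≡1

  normalise : ∀ {k} (v : Vec K k) → v ≢ 0ᵥ → ∃ λ l → l ≢ 0# × T (isNorm (l ·ᵥ v))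
  normalise []      v≢0 = ⊥-elim (v≢0 refl)
  normalise (x ∷ v) v≢0 with x ≟ 0#
  ... | yes x≡0 =
    let l , l≢0 , t = normalise v (v≢0 ∘ cong₂ _∷_ x≡0)
    in l , l≢0 , isNorm-0∷ (trans (cong (l *_) x≡0) (zeroʳ l)) t
  ... | no x≢0 =
    let x⁻¹ , xx⁻¹≡1 = inverse x x≢0
    in x⁻¹ , (λ x⁻¹≡0 → 0≢1 (trans (sym (trans (cong (x *_) x⁻¹≡0) (zeroʳ x))) xx⁻¹≡1))
           , subst (λ y → T (isNorm (y ∷ x⁻¹ ·ᵥ v))) (trans (sym xx⁻¹≡1) (*-comm x x⁻¹)) isNorm-1∷

  Separates : ∀ {k} → Vec K k → Vec K k → Vec K k → Set
  Separates h g w = dot h w ≡ 0# × dot g w ≢ 0#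

  separates-lead : ∀ {k x y} (h g u : Vec K k) → x ≡ 1# → dot g u ≢ y * dot h u →
                   Separates (x ∷ h) (y ∷ g) (- dot h u ∷ u)
  separates-lead {y = y} h g u refl gu≢y*hu = on-h , off-g
    where
    on-h : 1# * - dot h u + dot h u ≡ 0#
    on-h = trans (cong (_+ dot h u) (*-identityˡ _)) (-‿inverseˡ _)
    off-g : y * - dot h u + dot g u ≢ 0#
    off-g e = gu≢y*hu (trans (+-inverseʳ-unique _ _ e)
                             (trans (-‿distribʳ-* y (- dot h u)) (cong (y *_) (-‿involutive _))))

  separating : ∀ {k} {h g : Vec K k} → T (isNorm h) → T (isNorm g) → g ≢ h → ∃ (Separates h g)
  separating {h = x ∷ h} {y ∷ g} nh ng g≢h with isNorm-∷ nh | isNorm-∷ ng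
  ... | inj₁ (x≡0 , nh′) | inj₁ (y≡0 , ng′) =
    let w , hw≡0 , gw≢0 = separating nh′ ng′ (g≢h ∘ cong₂ _∷_ (trans y≡0 (sym x≡0)))
    in 0# ∷ w , trans (dot-0∷ x h w) hw≡0 , gw≢0 ∘ trans (sym (dot-0∷ y g w))
  ... | inj₁ (x≡0 , _) | inj₂ y≡1 =
    1# ∷ 0ᵥ , trans (dot-e₁ x h) x≡0 , λ e → 0≢1 (trans (sym e) (trans (dot-e₁ y g) y≡1))
  ... | inj₂ x≡1 | inj₁ (y≡0 , ng′) =
    let u , gu≢0 = dot-distinguishes g 0ᵥ (isNorm⇒≢0ᵥ ng′)
        y*hu≡0u = trans (cong (_* dot h u) y≡0) (trans (zeroˡ _) (sym (dot-0ᵥˡ u)))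
    in - dot h u ∷ u , separates-lead h g u x≡1 (λ e → gu≢0 (trans e y*hu≡0u))
  ... | inj₂ x≡1 | inj₂ y≡1 =
    let u , gu≢hu = dot-distinguishes g h (g≢h ∘ cong₂ _∷_ (trans y≡1 (sym x≡1)))
        y*hu≡hu = trans (cong (_* dot h u) y≡1) (*-identityˡ _)
    in - dot h u ∷ u , separates-lead h g u x≡1 (λ e → gu≢hu (trans e y*hu≡hu))
  -- The zero of t ↦ a + t * b if b ≢ 0#; an arbitrary value if b ≡ 0#.
  root : K → K → K
  root a b with b ≟ 0#
  ... | yes _   = 0#
  ... | no b≢0 = - a * proj₁ (inverse b b≢0)

  ≢root : ∀ {a b t} → (b ≡ 0# → a ≢ 0#) → t ≢ root a b → a + t * b ≢ 0#
  ≢root {a} {b} {t} b≡0⇒a≢0 t≢root with b ≟ 0#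
  ... | yes b≡0 = λ e → b≡0⇒a≢0 b≡0 (begin
    a            ≡⟨ +-identityʳ a ⟨
    a + 0#       ≡⟨ cong (a +_) (trans (cong (t *_) b≡0) (zeroʳ t)) ⟨
    a + t * b    ≡⟨ e ⟩
    0#           ∎)
    where open ≡-Reasoning
  ... | no b≢0 with inverse b b≢0
  ...   | b⁻¹ , bb⁻¹≡1 = λ e → t≢root (begin
    t              ≡⟨ *-identityʳ t ⟨
    t * 1#         ≡⟨ cong (t *_) bb⁻¹≡1 ⟨
    t * (b * b⁻¹)  ≡⟨ *-assoc t b b⁻¹ ⟨
    t * b * b⁻¹    ≡⟨ cong (_* b⁻¹) (+-inverseʳ-unique a (t * b) e) ⟩
    - a * b⁻¹      ∎)
    where open ≡-Reasoning

  -- v + t w stays on h, and each g j′ rules out at most one value of t: fewer than q in all.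
  avoid : ∀ {I : Set} {k} (h : Vec K k) (g : I → Vec K k) (js : List I) → length js < order F →
          (∀ {j} → j ∈ js → ∃ (Separates h (g j))) →
          ∃ λ v → dot h v ≡ 0# × (∀ {j} → j ∈ js → dot (g j) v ≢ 0#)
  avoid h g []       _         _   = 0ᵥ , dot-0ᵥʳ h , λ ()
  avoid h g (j ∷ js) |j∷js|<q sep
    with avoid h g js (ℕ.<-trans (ℕ.n<1+n _) |j∷js|<q) (sep ∘ there) | sep (here refl)
  ... | v , hv≡0 , gv≢0 | w , hw≡0 , gw≢0 = v +ᵥ t ·ᵥ w , on-h , off-g
    where
    roots : List K
    roots = List.map (λ j′ → root (dot (g j′) v) (dot (g j′) w)) (j ∷ js)
    fresh : ∃ λ t → t ∈ elements × t ∉ roots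
    fresh = pigeonhole-∉ _≟_ elements elements-unique roots
                         (subst (_< order F) (sym (length-map _ (j ∷ js))) |j∷js|<q)
    t : K
    t = proj₁ fresh
    t∉roots : t ∉ roots
    t∉roots = proj₂ (proj₂ fresh)
    on-h : dot h (v +ᵥ t ·ᵥ w) ≡ 0#
    on-h = trans (dot-linear h v w t)
                 (trans (cong₂ (λ a b → a + t * b) hv≡0 hw≡0)
                        (trans (cong (0# +_) (zeroʳ t)) (+-identityʳ 0#)))
    nondegenerate : ∀ {j′} → j′ ∈ j ∷ js → dot (g j′) w ≡ 0# → dot (g j′) v ≢ 0#
    nondegenerate (here refl)   gjw≡0 = ⊥-elim (gw≢0 gjw≡0)
    nondegenerate (there j′∈js) _     = gv≢0 j′∈js
    off-g : ∀ {j′} → j′ ∈ j ∷ js → dot (g j′) (v +ᵥ t ·ᵥ w) ≢ 0#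
    off-g {j′} j′∈ e = ≢root (nondegenerate j′∈)
                             (λ t≡root → t∉roots (subst (_∈ roots) (sym t≡root) (∈-map⁺ _ j′∈)))
                             (trans (sym (dot-linear (g j′) v w t)) e)

  χ-on : ∀ {H P : Point} → dot (proj₁ H) (proj₁ P) ≡ 0# → χ H P ≡ 1ₚ
  χ-on {H} {P} HP≡0 with dot (proj₁ H) (proj₁ P) ≟ 0#
  ... | yes _     = refl
  ... | no HP≢0 = ⊥-elim (HP≢0 HP≡0)

  χ-off : ∀ {H P : Point} → dot (proj₁ H) (proj₁ P) ≢ 0# → χ H P ≡ 0ₚ
  χ-off {H} {P} HP≢0 with dot (proj₁ H) (proj₁ P) ≟ 0#
  ... | yes HP≡0 = ⊥-elim (HP≢0 HP≡0)
  ... | no _     = refl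

  Point-≡ : ∀ {P Q : Point} → proj₁ P ≡ proj₁ Q → P ≡ Q
  Point-≡ {v , t} {.v , t′} refl = cong (v ,_) (T-irrelevant t t′)

  OnlyOn : ∀ {m} → (Fin m → Hyperplane) → Fin m → Point → Set
  OnlyOn Hs i P = χ (Hs i) P ≡ 1ₚ × (∀ k → k ≢ i → χ (Hs k) P ≡ 0ₚ)

  offOthers : ∀ {m} (Hs : Fin m → Hyperplane) → (∀ i j → Hs i ≡ Hs j → i ≡ j) → m < order F → ∀ i →
              ∃ λ v → dot (proj₁ (Hs i)) v ≡ 0# × (∀ k → k ≢ i → dot (proj₁ (Hs k)) v ≢ 0#)
  offOthers {m} Hs distinct m<q i =
    let v , hᵢv≡0 , hₖv≢0 = avoid (proj₁ (Hs i)) (proj₁ ∘ Hs) others |others|<q separates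
    in v , hᵢv≡0 , λ k k≢i → hₖv≢0 (∈-filter⁺ _ (∈-allFin k) k≢i)
    where
    others : List (Fin m)
    others = filter (λ k → ¬? (k Fin.≟ i)) (allFin m)
    |others|<q : length others < order F
    |others|<q = ℕ.≤-<-trans (ℕ.≤-trans (length-filter _ (allFin m)) (ℕ.≤-reflexive (length-tabulate id)))
                             m<q
    separates : ∀ {k} → k ∈ others → ∃ (Separates (proj₁ (Hs i)) (proj₁ (Hs k)))
    separates {k} k∈others =
      separating (proj₂ (Hs i)) (proj₂ (Hs k))
                 (λ Hₖ≡Hᵢ → proj₂ (∈-filter⁻ _ {xs = allFin m} k∈others) (distinct k i (Point-≡ Hₖ≡Hᵢ)))

  -- The second index j only serves to make the vector found by offOthers nonzero.
  onlyOn : ∀ {m} (Hs : Fin m → Hyperplane) → (∀ i j → Hs i ≡ Hs j → i ≡ j) → m < order F →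
           ∀ i j → j ≢ i → ∃ (OnlyOn Hs i)
  onlyOn Hs distinct m<q i j j≢i =
    let v , hᵢv≡0 , hₖv≢0 = offOthers Hs distinct m<q i
        l , l≢0 , l·v-normalised =
          normalise v (λ v≡0 → hₖv≢0 j j≢i (trans (cong (dot (h j)) v≡0) (dot-0ᵥʳ (h j))))
    in (l ·ᵥ v , l·v-normalised)
       , χ-on (trans (dot-·ᵥʳ (h i) v l) (trans (cong (l *_) hᵢv≡0) (zeroʳ l)))
       , λ k k≢i → χ-off (λ e → x*y≢0 l≢0 (hₖv≢0 k k≢i) (trans (sym (dot-·ᵥʳ (h k) v l)) e))
    where
    h : Fin _ → Vec K (suc n)
    h k = proj₁ (Hs k)

module HyperplaneCount where
  open import Data.Nat using (_+_; _*_; _∸_; _^_; _/_; _≤ᵇ_; _≡ᵇ_; NonZero)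
  open import Data.Nat.DivMod using (m/n≤m; m<n*o⇒m/o<n)
  open import Data.Nat.Primality using (prime⇒nonZero)

  isqrt≤ : ∀ k → isqrt k ≤ k
  isqrt≤ zero    = z≤n
  isqrt≤ (suc k) with suc (isqrt k) * suc (isqrt k) ≤ᵇ suc k
  ... | true  = s≤s (isqrt≤ k)
  ... | false = ℕ.m≤n⇒m≤1+n (isqrt≤ k)

  Δ≤q : ∀ p h n q → p ≤ q → Δ p h n q ≤ q
  Δ≤q p h n q p≤q with h ≡ᵇ 2
  ... | true  = ℕ.≤-trans (m/n≤m p (2 ^ n) {{ℕ.m^n≢0 2 n}}) p≤q
  ... | false = ℕ.≤-trans (m/n≤m (isqrt q) (2 ^ (n ∸ 2)) {{ℕ.m^n≢0 2 (n ∸ 2)}}) (isqrt≤ q)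

  ⌈/⌉≤ : ∀ a D t .{{_ : NonZero t}} → a ≤ D * t → (a + (t ∸ 1)) / t ≤ D
  ⌈/⌉≤ a D t@(suc t′) a≤D*t = ℕ.≤-pred (m<n*o⇒m/o<n (begin-strict
    a + t′       ≤⟨ ℕ.+-monoˡ-≤ t′ a≤D*t ⟩
    D * t + t′   <⟨ ℕ.+-monoʳ-< (D * t) (ℕ.n<1+n t′) ⟩
    D * t + t    ≡⟨ ℕ.+-comm (D * t) t ⟩
    suc D * t    ∎))
    where open ℕ.≤-Reasoning

  mc<q : ∀ {p h n q a} → Standing p h n q → a ≤ W p h n q → ceilDivθ a q (n ∸ 1) < q
  mc<q {p} {h} {n} {q} {a} st a≤W = ≤pred⇒< q>0 (ℕ.≤-trans mc≤Δ∸1 (ℕ.∸-monoˡ-≤ 1 (Δ≤q p h n q p≤q)))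
    where
    open Standing st
    mc≤Δ∸1 : ceilDivθ a q (n ∸ 1) ≤ Δ p h n q ∸ 1
    mc≤Δ∸1 = ⌈/⌉≤ a (Δ p h n q ∸ 1) (θ q (n ∸ 1)) {{θ-nonZero q (n ∸ 1)}} a≤W
    p≤q : p ≤ q
    p≤q = subst (p ≤_) (sym q≡p^h)
                (ℕ.≤-trans (ℕ.≤-reflexive (sym (ℕ.*-identityʳ p)))
                           (ℕ.^-monoʳ-≤ p {{prime⇒nonZero p-prime}} (ℕ.≤-trans (s≤s z≤n) h≥2)))
    q>0 : 0 < q
    q>0 = ℕ.<-trans (s≤s z≤n) q>27
    ≤pred⇒< : ∀ {m q} → 0 < q → m ≤ q ∸ 1 → m < q
    ≤pred⇒< {q = suc _} _ m≤q∸1 = s≤s m≤q∸1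

module TwoPartsNotMinimal (F : FiniteField) (n p : ℕ) (pp : Prime p) where
  open PG F n p pp
  open PrimeFieldArithmetic F n p pp
  open PointsOffHyperplanes F n p pp using (OnlyOn; onlyOn)

  subcodeword⇒¬Minimal : ∀ {c c′ P Q} → InCode c′ → (∀ R → c′ R ≢ 0ₚ → c R ≢ 0ₚ) →
                          c′ P ≡ 0ₚ → c P ≢ 0ₚ → c′ Q ≢ 0ₚ → ¬ Minimal c
  subcodeword⇒¬Minimal {c} {c′} {P} {Q} c′∈C supp-c′⊆supp-c c′P≡0 cP≢0 c′Q≢0 minimal
    with minimal c′ c′∈C supp-c′⊆supp-c
  ... | α , c′≡αc = c′Q≢0 (trans (c′≡αc Q) (trans (cong (_*ₚ c Q) α≡0) (*ₚ-zeroˡ (c Q))))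
    where
    α≡0 : α ≡ 0ₚ
    α≡0 = [ id , ⊥-elim ∘ cP≢0 ]′ (*ₚ≡0ₚ⇒≡0ₚ⊎≡0ₚ α (c P) (trans (sym (c′≡αc P)) c′P≡0))

  comb-onlyOn : ∀ {m} {Hs : Fin m → Hyperplane} {i P} (b : Fin m → Fp) → OnlyOn Hs i P → comb Hs b P ≡ b i
  comb-onlyOn {Hs = Hs} {i} {P} b (on-Hᵢ , off-Hₖ) = begin
    comb Hs b P          ≡⟨ sumₚ-select _ i (λ k k≢i → trans (cong (b k *ₚ_) (off-Hₖ k k≢i)) (*ₚ-zeroʳ (b k))) ⟩
    b i *ₚ χ (Hs i) P    ≡⟨ cong (b i *ₚ_) on-Hᵢ ⟩
    b i *ₚ 1ₚ            ≡⟨ *ₚ-identityʳ (b i) ⟩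
    b i                  ∎
    where open ≡-Reasoning

  module _ (c : Fun) {m : ℕ} (Hs : Fin m → Hyperplane) (a : Fin m → Fp) where
    open Partitions c Hs a

    restrCoeff : Labelling → Fin m → Fin m → Fp
    restrCoeff π i j = if ⌊ π j Fin.≟ π i ⌋ then a j else 0ₚ

    restrCoeff-same : ∀ {π i j} → π j ≡ π i → restrCoeff π i j ≡ a j
    restrCoeff-same {π} {i} {j} πj≡πi with π j Fin.≟ π i
    ... | yes _     = refl
    ... | no πj≢πi = ⊥-elim (πj≢πi πj≡πi)

    restrCoeff-other : ∀ {π i j} → π j ≢ π i → restrCoeff π i j ≡ 0ₚ
    restrCoeff-other {π} {i} {j} πj≢πi with π j Fin.≟ π i
    ... | yes πj≡πi = ⊥-elim (πj≢πi πj≡πi)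
    ... | no _      = refl

    restr≡comb : ∀ π i P → restr π i P ≡ comb Hs (restrCoeff π i) P
    restr≡comb π i P = sumₚ-cong termwise
      where
      termwise : ∀ j → (if ⌊ π j Fin.≟ π i ⌋ then a j *ₚ χ (Hs j) P else 0ₚ) ≡
                       restrCoeff π i j *ₚ χ (Hs j) P
      termwise j with π j Fin.≟ π i
      ... | yes _ = refl
      ... | no _  = sym (*ₚ-zeroˡ _)

    restr-InCode : ∀ π i → InCode (restr π i)
    restr-InCode π i = m , Hs , restrCoeff π i , restr≡comb π i

    restr-onlyOn : ∀ {π i k P} → OnlyOn Hs k P → restr π i P ≡ restrCoeff π i k
    restr-onlyOn {π} {i} {k} {P} P-onlyOn-Hₖ =
      trans (restr≡comb π i P) (comb-onlyOn (restrCoeff π i) P-onlyOn-Hₖ)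

    restr-split : ∀ {π i j} → π i ≢ π j → (∀ k → π k ≡ π i ⊎ π k ≡ π j) →
                  ∀ P → comb Hs a P ≡ restr π i P +ₚ restr π j P
    restr-split {π} {i} {j} πi≢πj cover P = trans (sumₚ-cong termwise) (sumₚ-distrib (term i) (term j))
      where
      term : Fin m → Fin m → Fp
      term r k = if ⌊ π k Fin.≟ π r ⌋ then a k *ₚ χ (Hs k) P else 0ₚ
      termwise : ∀ k → a k *ₚ χ (Hs k) P ≡ term i k +ₚ term j k
      termwise k with π k Fin.≟ π i | π k Fin.≟ π j
      ... | yes πk≡πi | yes πk≡πj = ⊥-elim (πi≢πj (trans (sym πk≡πi) πk≡πj))
      ... | yes _     | no _      = sym (+ₚ-identityʳ _)
      ... | no _      | yes _     = sym (+ₚ-identityˡ _)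
      ... | no πk≢πi  | no πk≢πj  = ⊥-elim ([ πk≢πi , πk≢πj ]′ (cover k))

    two-parts-merge : ∀ {π π′ i j} → IsNext π π′ → (∀ k → π k ≡ π i ⊎ π k ≡ π j) →
                      Adj π i j → ∀ k → π′ k ≡ π′ i
    two-parts-merge {π} {π′} {i} {j} next cover adj k with cover k
    ... | inj₁ πk≡πi = proj₂ (next k i) (inj₁ πk≡πi ◅ ε)
    ... | inj₂ πk≡πj = proj₂ (next k i) (inj₁ πk≡πj ◅ inj₂ (flip-Adj adj) ◅ ε)
      where
      flip-Adj : Adj π i j → Adj π j i
      flip-Adj (πi≢πj , P , hole , ri≢0 , rj≢0 , rest) =
        πi≢πj ∘ sym , P , hole , rj≢0 , ri≢0 , λ k πk≢πj πk≢πi → rest k πk≢πi πk≢πj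

    restr-support : ∀ {π π′ i j} → (∀ P → c P ≡ comb Hs a P) → IsNext π π′ →
                    π i ≢ π j → (∀ k → π k ≡ π i ⊎ π k ≡ π j) → TwoParts π′ →
                    ∀ P → restr π i P ≢ 0ₚ → c P ≢ 0ₚ
    restr-support {π} {π′} {i} {j} c≡comb next πi≢πj cover (i′ , j′ , π′i′≢π′j′ , _) P riP≢0 cP≡0 =
      π′i′≢π′j′ (trans (merged i′) (sym (merged j′)))
      where
      open ≡-Reasoning
      rjP≢0 : restr π j P ≢ 0ₚ
      rjP≢0 rjP≡0 = riP≢0 (begin
        restr π i P                 ≡⟨ +ₚ-identityʳ _ ⟨
        restr π i P +ₚ 0ₚ           ≡⟨ cong (restr π i P +ₚ_) rjP≡0 ⟨
        restr π i P +ₚ restr π j P  ≡⟨ restr-split πi≢πj cover P ⟨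
        comb Hs a P                 ≡⟨ c≡comb P ⟨
        c P                         ≡⟨ cP≡0 ⟩
        0ₚ                          ∎)
      adj : Adj π i j
      adj = πi≢πj , P , cP≡0 , riP≢0 , rjP≢0 , λ k πk≢πi πk≢πj → ⊥-elim ([ πk≢πi , πk≢πj ]′ (cover k))
      merged : ∀ k → π′ k ≡ π′ i
      merged = two-parts-merge next cover adj

    twoParts⇒¬Minimal : IsHc c Hs a → m < order F → ∀ {π π′} → IsNext π π′ →
                        TwoParts π → TwoParts π′ → ¬ Minimal c
    twoParts⇒¬Minimal hc m<q {π} next (i , j , πi≢πj , cover) twoParts′
      with onlyOn Hs (IsHc.distinct hc) m<q j i (πi≢πj ∘ cong π)
         | onlyOn Hs (IsHc.distinct hc) m<q i j (πi≢πj ∘ sym ∘ cong π)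
    ... | P , P-onlyOn-Hⱼ | Q , Q-onlyOn-Hᵢ =
      subcodeword⇒¬Minimal (restr-InCode π i) (restr-support sum next πi≢πj cover twoParts′)
                           riP≡0 cP≢0 riQ≢0
      where
      open IsHc hc using (sum; nonzero)
      cP≢0 : c P ≢ 0ₚ
      cP≢0 = nonzero j ∘ trans (sym (trans (sum P) (comb-onlyOn a P-onlyOn-Hⱼ)))
      riP≡0 : restr π i P ≡ 0ₚ
      riP≡0 = trans (restr-onlyOn P-onlyOn-Hⱼ) (restrCoeff-other {π} (πi≢πj ∘ sym))
      riQ≢0 : restr π i Q ≢ 0ₚ
      riQ≢0 = nonzero i ∘ trans (sym (trans (restr-onlyOn Q-onlyOn-Hᵢ) (restrCoeff-same {π} refl)))

open HyperplaneCount using (mc<q)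

corollary3p10 : (p h n : ℕ) (F : FiniteField) (st : Standing p h n (order F)) →
    (c : PG.Fun F n p (Standing.p-prime st)) →
    PG.InCode F n p (Standing.p-prime st) c →
    PG.wt F n p (Standing.p-prime st) c ≤ W p h n (order F) →
    {m : ℕ} (Hs : Fin m → PG.Hyperplane F n p (Standing.p-prime st)) (a : Fin m → PG.Fp F n p (Standing.p-prime st)) →
    PG.IsHc F n p (Standing.p-prime st) c Hs a →
    (πs : ℕ → Fin m → Fin m) →
    PG.Partitions.IsSequence F n p (Standing.p-prime st) c Hs a πs →
    PG.Partitions.LimitTwoParts F n p (Standing.p-prime st) c Hs a πs →
    ¬ PG.Minimal F n p (Standing.p-prime st) c
corollary3p10 p h n F st c _ wt≤W {m} Hs a hc πs (_ , next) (K , twoParts) =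
  twoParts⇒¬Minimal c Hs a hc m<q (next K) (twoParts K ℕ.≤-refl) (twoParts (suc K) (ℕ.n≤1+n K))
  where
  open TwoPartsNotMinimal F n p (Standing.p-prime st)
  m<q : m < order F
  m<q = subst (_< order F) (sym (PG.IsHc.size hc)) (mc<q st wt≤W)
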